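{- Let $F$ be a 2-CNF formula and $L$ a set of literals such that $SWRT(F,L)$ is true. Let $C=(l_1\vee l_2)$ be a clause of $F$ and $w$ a walk of $F$ from $\neg L$ containing $C$ such that $l_1$ is a first literal of $C$ with respect to $w$. Then $l_1$ is not a second literal of $C$ with respect to any walk of $F$ from $\neg L$.
   Context: A literal is a Boolean variable or its negation; $\neg$ denotes negation, and for a set $L$ of literals $\neg L=\{\neg l': l'\in L\}$. $Var(\cdot)$ denotes the set of variables. A 2-CNF formula $F$ is a conjunction of clauses each consisting of exactly two literals (a one-literal clause $(l)$ is written $(l\vee l)$; $(l_1\vee l_2)$ and $(l_2\vee l_1)$ are the same clause), with pairwise distinct clauses. A set of literals is non-contradictory if it contains no literal and its negation. A satisfying assignment of $F$ is a non-contradictory set $P$ of literals with $Var(P)=Var(F)$ such that each clause of $F$ contains a literal of $P$. $SWRT(F,L)$ means $F$ has a satisfying assignment $P$ with $P\cap \neg L=\emptyset$. A walk of $F$ is a nonempty sequence $(C_1,\dots,C_q)$ of (not necessarily distinct) clauses of $F$ where in each entry one literal is designated the first literal and the other the second literal, such that for every $i<q$ the second literal of $C_i$ is the negation of the first literal of $C_{i+1}$. The first literal of the walk is the first literal of $C_1$; the walk is from a set $M$ of literals if its first literal lies in $M$. For a clause $C$ and a walk $w$, a literal of $C$ is a first (resp. second) literal of $C$ with respect to $w$ if it is the designated first (resp. second) literal of some entry $C_i$ of $w$ with $C_i=C$. -}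

module Defs where

open import Data.Nat using (ℕ)
open import Data.Bool using (Bool; not)
open import Data.Product using (_×_; _,_; proj₁; proj₂; ∃; ∃-syntax)
open import Data.Sum using (_⊎_)
open import Data.Empty using (⊥)
open import Data.List using (List; []; _∷_; map; concatMap)
open import Data.List.Relation.Unary.All using (All)
open import Data.List.Relation.Unary.Any using (Any)
open import Data.List.Relation.Unary.AllPairs using (AllPairs)
open import Data.List.Relation.Unary.Linked using (Linked)
open import Data.List.Membership.Propositional using (_∈_)
open import Relation.Binary.PropositionalEquality using (_≡_)
open import Relation.Nullary using (¬_)
open import Function.Bundles using (_⇔_)

record Literal : Set where
  constructor lit
  field
    var  : ℕ
    sign : Bool
open Literal public

neg : Literal → Literal
neg (lit v b) = lit v (not b)

_∈¬_ : Literal → List Literal → Set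
l ∈¬ L = ∃[ l' ] (l' ∈ L × l ≡ neg l')

-- A clause (l₁ ∨ l₂) is given by an ordered pair; clauses are equal up to swapping.
Clause : Set
Clause = Literal × Literal

_≈C_ : Clause → Clause → Set
(a , b) ≈C (c , d) = (a ≡ c × b ≡ d) ⊎ (a ≡ d × b ≡ c)

_∈C_ : Clause → List Clause → Set
C ∈C F = Any (C ≈C_) F

Is2CNF : List Clause → Set
Is2CNF F = AllPairs (λ C D → ¬ (C ≈C D)) F

Vars : List Literal → List ℕ
Vars P = map var P

VarsF : List Clause → List ℕ
VarsF F = concatMap (λ C → var (proj₁ C) ∷ var (proj₂ C) ∷ []) F

NonContradictory : List Literal → Set
NonContradictory P = ∀ l → l ∈ P → neg l ∈ P → ⊥

IsSatAssignment : List Clause → List Literal → Set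
IsSatAssignment F P =
  NonContradictory P ×
  (∀ v → (v ∈ Vars P) ⇔ (v ∈ VarsF F)) ×
  All (λ C → proj₁ C ∈ P ⊎ proj₂ C ∈ P) F

SWRT : List Clause → List Literal → Set
SWRT F L = ∃[ P ] (IsSatAssignment F P × (∀ l → l ∈ P → ¬ (l ∈¬ L)))

-- An entry of a walk: a clause of F with designated (first , second) literal.
Entry : Set
Entry = Literal × Literal

record Walk (F : List Clause) : Set where
  constructor walk
  field
    hd    : Entry
    tl    : List Entry
    inF   : All (λ e → e ∈C F) (hd ∷ tl)
    chain : Linked (λ e e' → proj₂ e ≡ neg (proj₁ e')) (hd ∷ tl)
open Walk public

entries : ∀ {F} → Walk F → List Entry
entries w = hd w ∷ tl w

firstLit : ∀ {F} → Walk F → Literal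
firstLit w = proj₁ (hd w)

WalkFromNeg : ∀ {F} → Walk F → List Literal → Set
WalkFromNeg w L = firstLit w ∈¬ L

IsFirstLitOf : ∀ {F} → Literal → Clause → Walk F → Set
IsFirstLitOf l C w = Any (λ e → (e ≈C C) × proj₁ e ≡ l) (entries w)

IsSecondLitOf : ∀ {F} → Literal → Clause → Walk F → Set
IsSecondLitOf l C w = Any (λ e → (e ≈C C) × proj₂ e ≡ l) (entries w)

module Submission where

-- Fix a satisfying assignment P of F that avoids ¬L.  Call an entry
-- of a walk *oriented* by P when its first literal is false under P and its
-- second literal is true.  Orientation propagates along a walk: an entry
-- whose first literal is false has a true second literal (its clause is
-- satisfied), and then the next entry's first literal, the negation of that
-- true literal, is false (P is non-contradictory).  A walk from ¬L starts
-- with a literal false under P, so all its entries are oriented.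
--
-- Hence l₁, being a first literal of (l₁ ∨ l₂) in one walk from ¬L, is false
-- under P, while being a second literal of it in another walk from ¬L would
-- make it true: a contradiction.

open import Defs
open import Data.List using (List; _∷_)
open import Data.Product using (_,_; _×_; proj₁; proj₂)
open import Data.Sum using (_⊎_; inj₁; inj₂)
open import Data.List.Relation.Unary.All as All using (All; []; _∷_)
open import Data.List.Relation.Unary.Linked using (Linked; [-]; _∷_)
open import Data.List.Membership.Propositional using (_∈_; _∉_)
open import Relation.Binary.PropositionalEquality using (_≡_; refl; subst)
open import Data.Empty using (⊥-elim)
open import Relation.Nullary using (¬_)

Satisfies : List Literal → Clause → Set
Satisfies P C = proj₁ C ∈ P ⊎ proj₂ C ∈ P

satisfies-resp-≈C : ∀ {P C D} → C ≈C D → Satisfies P D → Satisfies P C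
satisfies-resp-≈C (inj₁ (refl , refl)) s        = s
satisfies-resp-≈C (inj₂ (refl , refl)) (inj₁ x) = inj₂ x
satisfies-resp-≈C (inj₂ (refl , refl)) (inj₂ y) = inj₁ y

entry-satisfied : ∀ {P F e} → All (Satisfies P) F → e ∈C F → Satisfies P e
entry-satisfied sat e∈F = All.lookupWith (λ s e≈C → satisfies-resp-≈C e≈C s) sat e∈F

Consecutive : Entry → Entry → Set
Consecutive e e' = proj₂ e ≡ neg (proj₁ e')

Oriented : List Literal → Entry → Set
Oriented P e = proj₁ e ∉ P × proj₂ e ∈ P

satisfied-oriented : ∀ {P e} → Satisfies P e → proj₁ e ∉ P → Oriented P e
satisfied-oriented (inj₁ first∈) first∉ = ⊥-elim (first∉ first∈)
satisfied-oriented (inj₂ second∈) first∉ = first∉ , second∈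

chain-oriented : ∀ {P e es} → NonContradictory P →
                 All (Satisfies P) (e ∷ es) → Linked Consecutive (e ∷ es) →
                 proj₁ e ∉ P → All (Oriented P) (e ∷ es)
chain-oriented nc (s ∷ []) [-] first∉ = satisfied-oriented s first∉ ∷ []
chain-oriented {P} {e} {e' ∷ _} nc (s ∷ ss) (link ∷ links) first∉ =
  oriented ∷ chain-oriented nc ss links next-first∉
  where
  oriented : Oriented P e
  oriented = satisfied-oriented s first∉
  -- the next first literal is false: its negation is the true literal proj₂ e
  next-first∉ : proj₁ e' ∉ P
  next-first∉ next∈ = nc (proj₁ e') next∈ (subst (_∈ P) link (proj₂ oriented))

walk-oriented : ∀ {P F} → NonContradictory P → All (Satisfies P) F →
                (w : Walk F) → firstLit w ∉ P → All (Oriented P) (entries w)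
walk-oriented nc sat w first∉ =
  chain-oriented nc (All.map (entry-satisfied sat) (inF w)) (chain w) first∉

first-literal-false : ∀ {P F l C} (w : Walk F) → All (Oriented P) (entries w) →
                      IsFirstLitOf l C w → l ∉ P
first-literal-false {P} w oriented first with All.lookupAny oriented first
... | (first∉ , _) , (_ , first≡l) = subst (_∉ P) first≡l first∉

second-literal-true : ∀ {P F l C} (w : Walk F) → All (Oriented P) (entries w) →
                      IsSecondLitOf l C w → l ∈ P
second-literal-true {P} w oriented second with All.lookupAny oriented second
... | (_ , second∈) , (_ , second≡l) = subst (_∈ P) second≡l second∈

lemma2 : (F : List Clause) → Is2CNF F → (L : List Literal) → SWRT F L →
         (l₁ l₂ : Literal) → (l₁ , l₂) ∈C F →
         (w : Walk F) → WalkFromNeg w L →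
         IsFirstLitOf l₁ (l₁ , l₂) w →
         (w' : Walk F) → WalkFromNeg w' L →
         ¬ IsSecondLitOf l₁ (l₁ , l₂) w'
lemma2 F _ L (P , (nc , _ , sat) , avoid) l₁ l₂ _ w wL first w' wL' second =
  first-literal-false w (oriented w wL) first
    (second-literal-true w' (oriented w' wL') second)
  where
  -- a walk from ¬L starts with a literal outside P, as P avoids ¬L
  oriented : (v : Walk F) → WalkFromNeg v L → All (Oriented P) (entries v)
  oriented v vL = walk-oriented nc sat v (λ first∈ → avoid _ first∈ vL)
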